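{- Let $(X,\mathcal{B})$ be a $t$-$(v,k,1)$-design used as a distribution design for a combinatorial repairable threshold scheme, and let $B\in\mathcal{B}$ be the block of a player. Suppose every other player is available independently with probability $p$, and let $q=1-p$. For $1\le j\le t$ let $r_j=\binom{v-j}{t-j}\big/\binom{k-j}{t-j}$, and for $1\le i\le k$ let \[e_i=\sum_{j=1}^{\min\{i,t-1\}}(-1)^{j+1}\binom{i}{j}(r_j-1).\] Then the probability that there is at least one available repair set for $B$ is \[\mathcal{R}(p)=1-\binom{k}{1}q^{e_1}+\binom{k}{2}q^{e_2}-\binom{k}{3}q^{e_3}+\cdots+(-1)^{k+1}\binom{k}{k}q^{e_k}.\]
   Context: A $t$-$(v,k,1)$-design is a set system $(X,\mathcal{B})$ with $|X|=v$, every block of size $k$, and every set of $t$ points in exactly one block; $r_j$ is the number of blocks containing any given set of $j$ points. Blocks correspond to players. A repair set for the player with block $B$ is a set of other blocks (players) whose union contains $B$; it is available if all its players are available. $\mathcal{R}(p)$ is the probability that at least one available repair set exists.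
   Formalization: The availability probability p of the other players takes only rational values in [0,1]. -}

module Defs where

open import Data.Nat as ℕ using (ℕ; zero; suc; _∸_; _⊓_)
open import Data.Nat.DivMod using (_/_)
open import Data.Nat.Combinatorics using (_C_)
open import Data.Integer as ℤ using (ℤ; +_)
open import Data.Rational as ℚ using (ℚ; 0ℚ; 1ℚ; _+_; _*_; _-_; _≤_)
open import Data.Fin using (Fin)
open import Data.Fin.Subset using (Subset; _∈_; _∉_; _⊆_; ∣_∣; inside; outside)
open import Data.Vec using (Vec; []; _∷_)
open import Data.List using (List; []; _∷_; map; _++_; applyUpTo; foldr)
open import Data.Product using (∃; _×_)
open import Relation.Binary.PropositionalEquality using (_≡_)
open import Relation.Nullary using (Dec; does)
open import Data.Bool using (if_then_else_)

record IsDesign (t v k b : ℕ) (blocks : Fin b → Subset v) : Set where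
  field
    blockSize : ∀ i → ∣ blocks i ∣ ≡ k
    covered   : ∀ (T : Subset v) → ∣ T ∣ ≡ t → ∃ λ i → T ⊆ blocks i
    unique    : ∀ (T : Subset v) → ∣ T ∣ ≡ t → ∀ i j →
                T ⊆ blocks i → T ⊆ blocks j → i ≡ j

-- R (a set of players = block indices) is a repair set for player β:
-- it consists of players other than β and the union of their blocks contains blocks β.
IsRepairSet : ∀ {v b} → (Fin b → Subset v) → Fin b → Subset b → Set
IsRepairSet blocks β R =
  β ∉ R × (∀ x → x ∈ blocks β → ∃ λ i → i ∈ R × x ∈ blocks i)

HasAvailableRepairSet : ∀ {v b} → (Fin b → Subset v) → Fin b → Subset b → Set
HasAvailableRepairSet blocks β σ = ∃ λ R → IsRepairSet blocks β R × R ⊆ σ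

allSubsets : (n : ℕ) → List (Subset n)
allSubsets zero    = [] ∷ []
allSubsets (suc n) =
  map (outside ∷_) (allSubsets n) ++ map (inside ∷_) (allSubsets n)

sumℚ : List ℚ → ℚ
sumℚ = foldr _+_ 0ℚ

weight : ∀ {n} → ℚ → Subset n → ℚ
weight p []             = 1ℚ
weight p (inside  ∷ σ)  = p * weight p σ
weight p (outside ∷ σ)  = (1ℚ - p) * weight p σ

Prob : ∀ {n} (E : Subset n → Set) → ((σ : Subset n) → Dec (E σ)) → ℚ → ℚ
Prob {n} E dec p =
  sumℚ (map (λ σ → weight p σ * (if does (dec σ) then 1ℚ else 0ℚ)) (allSubsets n))

_^ℚ_ : ℚ → ℕ → ℚ
x ^ℚ zero  = 1ℚ
x ^ℚ suc n = x * (x ^ℚ n)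

signℚ : ℕ → ℚ
signℚ zero    = 1ℚ
signℚ (suc n) = ℚ.- signℚ n

signℤ : ℕ → ℤ
signℤ zero    = + 1
signℤ (suc n) = ℤ.- signℤ n

-- natural division, returning 0 for a zero divisor (never used: k ≥ t)
divℕ : ℕ → ℕ → ℕ
divℕ m zero    = 0
divℕ m (suc n) = m / suc n

r : (t v k j : ℕ) → ℕ
r t v k j = divℕ ((v ∸ j) C (t ∸ j)) ((k ∸ j) C (t ∸ j))

e : (t v k i : ℕ) → ℤ
e t v k i = foldr ℤ._+_ (+ 0)
  (applyUpTo (λ j′ → let j = suc j′ in
       signℤ (suc j) ℤ.* (+ (i C j)) ℤ.* (+ r t v k j ℤ.- + 1))
     (i ⊓ (t ∸ 1)))

-- 1 - C(k,1) q^{e_1} + C(k,2) q^{e_2} - ... + (-1)^{k+1} C(k,k) q^{e_k}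
-- (e_i ≥ 0, being the number of blocks other than B meeting a fixed i-subset of B;
--  the exponent is taken as the natural number ∣ e_i ∣.)
repairFormula : (t v k : ℕ) → ℚ → ℚ
repairFormula t v k p =
  1ℚ + sumℚ (applyUpTo (λ i′ → let i = suc i′ in
          signℚ i * ((+ (k C i)) ℚ./ 1) * ((1ℚ - p) ^ℚ ℤ.∣ e t v k i ∣)) k)

module Submission where

-- Player β can be repaired exactly when every point of B is held by some
-- available player other than β.  If U(σ) denotes the points held by no such
-- player, the indicator of B ∩ U(σ) = ∅ is ∑_{I ⊆ B ∩ U(σ)} (-1)^{|I|}.  For a
-- fixed I, "I ⊆ U(σ)" says that no player of meeting(I) (the players other
-- than β whose blocks meet I) is available, which has probability
-- q^{|meeting I|}.  So R(p) = ∑_{I ⊆ B} (-1)^{|I|} q^{|meeting I|}.  A second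
-- inclusion–exclusion, over the points of I, together with the double count
-- "a j-set, j ≤ t, lies in exactly r_j blocks", gives |meeting I| = e_{|I|};
-- grouping the sets I by size yields the formula.

open import Defs
open import Data.Nat using (ℕ; _≤_)
open import Data.Rational using (ℚ; 0ℚ; 1ℚ) renaming (_≤_ to _≤ℚ_)
open import Data.Fin using (Fin)
open import Data.Fin.Subset using (Subset)
open import Relation.Nullary using (Dec)
open import Relation.Binary.PropositionalEquality using (_≡_)

open import Level using (0ℓ)
open import Algebra.Bundles using (CommutativeSemiring; CommutativeRing)
open import Data.Bool using (Bool; true; false; _∧_; not; if_then_else_)
open import Data.Bool.Properties using (∧-zeroʳ; ∧-identityʳ; T-≡)
open import Data.Empty using (⊥-elim)
open import Data.Fin as Fin using (toℕ)
open import Data.Fin.Properties using (_≟_; any?)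
open import Data.Fin.Subset using (_∈_; _∉_; _⊆_; _∩_; ⊥; ⊤; ∣_∣; inside; outside)
open import Data.Fin.Subset.Properties
  using (_⊆?_; _∈?_; nonempty?; ∉⊥; ⊥⊆; ⊆⊤; ⊆-trans; drop-∷-⊆; out⊆; in⊆in;
         p∩q⊆p; p∩q⊆q; x∈p∩q⁺; x∈p∩q⁻; ∣⊥∣≡0; ∣⊤∣≡n)
import Data.List as List
open import Data.Nat as ℕ using (zero; suc; _<_; _≡ᵇ_; _∸_; z≤n; s≤s)
open import Data.Nat.Combinatorics using (_C_; nCk+nC[k+1]≡[n+1]C[k+1]; k>n⇒nCk≡0)
open import Data.Nat.DivMod using (m*n/n≡m)
open import Data.Nat.Properties
  using (_<?_; n<1+n; +-suc; ≤-trans; m≤m+n; m+n∸n≡m; ≡ᵇ⇒≡; ∸-monoˡ-≤; <⇒≤; ≮⇒≥; <⇒≱)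
  renaming (+-identityʳ to +-identityʳℕ; *-identityˡ to *-identityˡℕ;
            *-identityʳ to *-identityʳℕ; *-zeroʳ to *-zeroʳℕ;
            +-*-commutativeSemiring to ℕ-semiring)
open import Data.Product using (∃; _×_; _,_; proj₁; proj₂)
open import Data.Vec using ([]; _∷_; here; tabulate)
open import Data.Vec.Properties using (lookup∘tabulate; []=⇒lookup; lookup⇒[]=)
open import Function using (_∘_; _⟨_⟩_)
open import Function.Bundles using (Equivalence; _⇔_; mk⇔)
open import Relation.Nullary using (does; yes; no; ¬_)
open import Relation.Nullary.Decidable using (dec-true; does-⇔; _×-dec_; ¬?)
open import Relation.Unary using (Decidable)
open import Relation.Binary.PropositionalEquality
  using (_≢_; refl; sym; trans; cong; cong₂; subst; module ≡-Reasoning)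
open ≡-Reasoning

gap : ∀ {n} → Subset n → Subset n → ℕ
gap []            []            = 0
gap (outside ∷ P) (outside ∷ Q) = gap P Q
gap (outside ∷ P) (inside  ∷ Q) = suc (gap P Q)
gap (inside  ∷ P) (_       ∷ Q) = gap P Q

gap-⊥ : ∀ {n} (Q : Subset n) → gap ⊥ Q ≡ ∣ Q ∣
gap-⊥ []            = refl
gap-⊥ (outside ∷ Q) = gap-⊥ Q
gap-⊥ (inside  ∷ Q) = cong suc (gap-⊥ Q)

gap-size : ∀ {n} (P Q : Subset n) → P ⊆ Q → gap P Q ℕ.+ ∣ P ∣ ≡ ∣ Q ∣
gap-size []            []            P⊆Q = refl
gap-size (outside ∷ P) (outside ∷ Q) P⊆Q = gap-size P Q (drop-∷-⊆ P⊆Q)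
gap-size (outside ∷ P) (inside  ∷ Q) P⊆Q = cong suc (gap-size P Q (drop-∷-⊆ P⊆Q))
gap-size (inside  ∷ P) (inside  ∷ Q) P⊆Q =
  trans (+-suc _ _) (cong suc (gap-size P Q (drop-∷-⊆ P⊆Q)))
gap-size (inside  ∷ P) (outside ∷ Q) P⊆Q with () ← P⊆Q here

subset-of-size : ∀ {n} (J : Subset n) m → m ≤ ∣ J ∣ → ∃ λ T → T ⊆ J × ∣ T ∣ ≡ m
subset-of-size {n} J        zero    _ = ⊥ , ⊥⊆ , ∣⊥∣≡0 n
subset-of-size (outside ∷ J) (suc m) m<∣J∣ with subset-of-size J (suc m) m<∣J∣
... | T , T⊆J , ∣T∣≡m = outside ∷ T , out⊆ T⊆J , ∣T∣≡m
subset-of-size (inside  ∷ J) (suc m) (s≤s m≤∣J∣) with subset-of-size J m m≤∣J∣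
... | T , T⊆J , ∣T∣≡m = inside ∷ T , in⊆in T⊆J , cong suc ∣T∣≡m

setOf : ∀ {n} {P : Fin n → Set} → Decidable P → Subset n
setOf P? = tabulate (does ∘ P?)

∈-setOf⁺ : ∀ {n} {P : Fin n → Set} (P? : Decidable P) {x} → P x → x ∈ setOf P?
∈-setOf⁺ P? {x} px = lookup⇒[]= x _ (trans (lookup∘tabulate (does ∘ P?) x) (dec-true (P? x) px))

∈-setOf⁻ : ∀ {n} {P : Fin n → Set} (P? : Decidable P) {x} → x ∈ setOf P? → P x
∈-setOf⁻ P? {x} x∈ = from-does (P? x) (trans (sym (lookup∘tabulate (does ∘ P?) x)) ([]=⇒lookup x∈))
  where
  from-does : ∀ {A : Set} (a? : Dec A) → does a? ≡ true → A
  from-does (yes a) _ = a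

does-⊆?-∩ : ∀ {n} (J P Q : Subset n) → does (J ⊆? P ∩ Q) ≡ does (J ⊆? P) ∧ does (J ⊆? Q)
does-⊆?-∩ J P Q = does-⇔ (mk⇔ split join) (J ⊆? P ∩ Q) ((J ⊆? P) ×-dec (J ⊆? Q))
  where
  split : J ⊆ P ∩ Q → J ⊆ P × J ⊆ Q
  split J⊆P∩Q = (λ x∈J → p∩q⊆p P Q (J⊆P∩Q x∈J)) , (λ x∈J → p∩q⊆q P Q (J⊆P∩Q x∈J))
  join : J ⊆ P × J ⊆ Q → J ⊆ P ∩ Q
  join (J⊆P , J⊆Q) x∈J = x∈p∩q⁺ (J⊆P x∈J , J⊆Q x∈J)

element : ∀ {n} (A : Subset n) → ¬ A ⊆ ⊥ → ∃ λ x → x ∈ A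
element A A≢∅ with nonempty? A
... | yes ne = ne
... | no  ¬ne = ⊥-elim (A≢∅ (λ x∈A → ⊥-elim (¬ne (_ , x∈A))))

C-positive : ∀ n m → m ≤ n → 0 < n C m
C-positive n       zero    _         = s≤s z≤n
C-positive (suc n) (suc m) (s≤s m≤n) = ≤-trans (C-positive n m m≤n)
  (subst (n C m ≤_) (nCk+nC[k+1]≡[n+1]C[k+1] n m) (m≤m+n (n C m) (n C suc m)))

divℕ-cancel : ∀ m c → 0 < c → divℕ (m ℕ.* c) c ≡ m
divℕ-cancel m (suc c) _ = m*n/n≡m m (suc c)

≡ᵇ-shift : ∀ i j t → j ≤ t → (i ℕ.+ j ≡ᵇ t) ≡ (i ≡ᵇ t ∸ j)
≡ᵇ-shift i zero    t       z≤n       = cong (_≡ᵇ t) (+-identityʳℕ i)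
≡ᵇ-shift i (suc j) (suc t) (s≤s j≤t) = trans (cong (_≡ᵇ suc t) (+-suc i j)) (≡ᵇ-shift i j t j≤t)

succ-<-∸1 : ∀ t j → j < t ∸ 1 → suc j < t
succ-<-∸1 (suc t) j j<t = s≤s j<t

∸1-≤-succ : ∀ t j → t ∸ 1 ≤ j → t ≤ suc j
∸1-≤-succ zero    j _   = z≤n
∸1-≤-succ (suc t) j t≤j = s≤s t≤j

-- Finite sums over a commutative semiring whose setoid equality is
-- propositional (as for ℕ, ℤ and ℚ), so that we may reason with ≡ and cong.
module FiniteSums (R : CommutativeSemiring 0ℓ 0ℓ)
                  (≈⇒≡ : ∀ {x y} → CommutativeSemiring._≈_ R x y → x ≡ y) where

  open CommutativeSemiring R using (Carrier; _+_; _*_; 0#; 1#; semiring)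
  private module R = CommutativeSemiring R
  open import Algebra.Properties.Semiring.Sum semiring public
    using (sum; sum-syntax; sum-cong-≗)
  open import Algebra.Properties.Semiring.Sum semiring
    using (∑-distrib-+; *-distribˡ-sum; *-distribʳ-sum; sum-replicate-zero)
  open import Algebra.Properties.Semiring.Mult semiring using (×-homo-+) renaming (_×_ to _·_)
  open import Algebra.Properties.CommutativeSemigroup R.+-commutativeSemigroup
    using (interchange)

  +-comm : ∀ x y → x + y ≡ y + x
  +-comm x y = ≈⇒≡ (R.+-comm x y)

  +-assoc : ∀ x y z → (x + y) + z ≡ x + (y + z)
  +-assoc x y z = ≈⇒≡ (R.+-assoc x y z)

  +-identityˡ : ∀ x → 0# + x ≡ x
  +-identityˡ x = ≈⇒≡ (R.+-identityˡ x)

  +-identityʳ : ∀ x → x + 0# ≡ x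
  +-identityʳ x = ≈⇒≡ (R.+-identityʳ x)

  +-interchange : ∀ a b c d → (a + b) + (c + d) ≡ (a + c) + (b + d)
  +-interchange a b c d = ≈⇒≡ (interchange a b c d)

  *-identityˡ : ∀ x → 1# * x ≡ x
  *-identityˡ x = ≈⇒≡ (R.*-identityˡ x)

  *-identityʳ : ∀ x → x * 1# ≡ x
  *-identityʳ x = ≈⇒≡ (R.*-identityʳ x)

  zeroˡ : ∀ x → 0# * x ≡ 0#
  zeroˡ x = ≈⇒≡ (R.zeroˡ x)

  zeroʳ : ∀ x → x * 0# ≡ 0#
  zeroʳ x = ≈⇒≡ (R.zeroʳ x)

  distribˡ : ∀ x y z → x * (y + z) ≡ x * y + x * z
  distribˡ x y z = ≈⇒≡ (R.distribˡ x y z)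

  distribʳ : ∀ x y z → (y + z) * x ≡ y * x + z * x
  distribʳ x y z = ≈⇒≡ (R.distribʳ x y z)

  χ : Bool → Carrier
  χ true  = 1#
  χ false = 0#

  χ-∧ : ∀ a c → χ (a ∧ c) ≡ χ a * χ c
  χ-∧ true  c = sym (*-identityˡ (χ c))
  χ-∧ false c = sym (zeroˡ (χ c))

  nat : ℕ → Carrier
  nat n = n · 1#

  ∑-+ : ∀ n (f g : Fin n → Carrier) → ∑[ i < n ] (f i + g i) ≡ ∑[ i < n ] f i + ∑[ i < n ] g i
  ∑-+ n f g = ≈⇒≡ (∑-distrib-+ f g)

  ∑-*ˡ : ∀ n c (f : Fin n → Carrier) → c * ∑[ i < n ] f i ≡ ∑[ i < n ] (c * f i)
  ∑-*ˡ n c f = ≈⇒≡ (*-distribˡ-sum c f)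

  ∑-*ʳ : ∀ n c (f : Fin n → Carrier) → (∑[ i < n ] f i) * c ≡ ∑[ i < n ] (f i * c)
  ∑-*ʳ n c f = ≈⇒≡ (*-distribʳ-sum c f)

  sum-zero : ∀ n (f : Fin n → Carrier) → (∀ i → f i ≡ 0#) → sum f ≡ 0#
  sum-zero n f f≡0 = trans (sum-cong-≗ f≡0) (≈⇒≡ (sum-replicate-zero n))

  Σℕ : ℕ → (ℕ → Carrier) → Carrier
  Σℕ n f = ∑[ i < n ] f (toℕ i)

  Σℕ-cong : ∀ n {f g : ℕ → Carrier} → (∀ i → f i ≡ g i) → Σℕ n f ≡ Σℕ n g
  Σℕ-cong n f≗g = sum-cong-≗ {n} (λ i → f≗g (toℕ i))

  Σℕ-+ : ∀ n f g → Σℕ n (λ i → f i + g i) ≡ Σℕ n f + Σℕ n g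
  Σℕ-+ n f g = ∑-+ n (f ∘ toℕ) (g ∘ toℕ)

  Σℕ-applyUpTo : ∀ n f → Σℕ n f ≡ List.foldr _+_ 0# (List.applyUpTo f n)
  Σℕ-applyUpTo zero    f = refl
  Σℕ-applyUpTo (suc n) f = cong (f 0 +_) (Σℕ-applyUpTo n (f ∘ suc))

  Σℕ-snoc : ∀ n f → Σℕ (suc n) f ≡ Σℕ n f + f n
  Σℕ-snoc zero    f = +-comm (f 0) 0#
  Σℕ-snoc (suc n) f = trans (cong (f 0 +_) (Σℕ-snoc n (f ∘ suc))) (sym (+-assoc _ _ _))

  Σℕ-select : ∀ n d (h : ℕ → Carrier) → (∀ i → n ≤ i → h i ≡ 0#) →
              Σℕ n (λ i → h i * χ (i ≡ᵇ d)) ≡ h d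
  Σℕ-select zero    d       h h≡0 = sym (h≡0 d z≤n)
  Σℕ-select (suc n) zero    h h≡0 =
    trans (cong₂ _+_ (*-identityʳ (h 0)) (sum-zero n _ (λ i → zeroʳ _))) (+-identityʳ _)
  Σℕ-select (suc n) (suc d) h h≡0 =
    trans (cong₂ _+_ (zeroʳ (h 0)) (Σℕ-select n d (h ∘ suc) (λ i n≤i → h≡0 (suc i) (s≤s n≤i))))
          (+-identityˡ _)

  Σℕ-truncate : ∀ m c (f g : ℕ → Carrier) → (∀ j → j < c → f j ≡ g j) →
                (∀ j → c ≤ j → f j ≡ 0#) → Σℕ m f ≡ Σℕ (m ℕ.⊓ c) g
  Σℕ-truncate zero    c       f g f≡g f≡0 = refl
  Σℕ-truncate (suc m) zero    f g f≡g f≡0 = sum-zero (suc m) _ (λ j → f≡0 (toℕ j) z≤n)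
  Σℕ-truncate (suc m) (suc c) f g f≡g f≡0 =
    cong₂ _+_ (f≡g 0 (s≤s z≤n))
              (Σℕ-truncate m c (f ∘ suc) (g ∘ suc) (λ j j<c → f≡g (suc j) (s≤s j<c))
                                                     (λ j c≤j → f≡0 (suc j) (s≤s c≤j)))

  Bin : ℕ → (ℕ → Carrier) → Carrier
  Bin m h = Σℕ (suc m) (λ i → nat (m C i) * h i)

  nat-+ : ∀ m n → nat (m ℕ.+ n) ≡ nat m + nat n
  nat-+ m n = ≈⇒≡ (×-homo-+ 1# m n)

  Bin-pascal : ∀ m h → Bin m h + Bin m (h ∘ suc) ≡ Bin (suc m) h
  Bin-pascal m h = begin
    (a + Σℕ m upper) + Bin m (h ∘ suc)         ≡⟨ +-assoc a _ _ ⟩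
    a + (Σℕ m upper + Bin m (h ∘ suc))         ≡⟨ cong (a +_) (+-comm _ _) ⟩
    a + (Σℕ (suc m) lower + Σℕ m upper)        ≡⟨ cong (λ z → a + (Σℕ (suc m) lower + z)) upper-extended ⟨
    a + (Σℕ (suc m) lower + Σℕ (suc m) upper)  ≡⟨ cong (a +_) (Σℕ-+ (suc m) lower upper) ⟨
    a + Σℕ (suc m) (λ i → lower i + upper i)   ≡⟨ cong (a +_) (Σℕ-cong (suc m) pascal-term) ⟩
    a + Σℕ (suc m) (λ i → nat (suc m C suc i) * h (suc i)) ∎
    where
    a = nat (m C 0) * h 0
    lower upper : ℕ → Carrier
    lower i = nat (m C i) * h (suc i)
    upper i = nat (m C suc i) * h (suc i)
    -- the extra top term carries C(m, m+1) = 0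
    upper-extended : Σℕ (suc m) upper ≡ Σℕ m upper
    upper-extended = begin
      Σℕ (suc m) upper                         ≡⟨ Σℕ-snoc m upper ⟩
      Σℕ m upper + nat (m C suc m) * h (suc m) ≡⟨ cong (λ c → Σℕ m upper + nat c * h (suc m))
                                                       (k>n⇒nCk≡0 (n<1+n m)) ⟩
      Σℕ m upper + 0# * h (suc m)              ≡⟨ cong (Σℕ m upper +_) (zeroˡ (h (suc m))) ⟩
      Σℕ m upper + 0#                          ≡⟨ +-identityʳ _ ⟩
      Σℕ m upper                               ∎
    pascal-term : ∀ i → lower i + upper i ≡ nat (suc m C suc i) * h (suc i)
    pascal-term i = begin
      nat (m C i) * h (suc i) + nat (m C suc i) * h (suc i) ≡⟨ distribʳ (h (suc i)) _ _ ⟨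
      (nat (m C i) + nat (m C suc i)) * h (suc i)          ≡⟨ cong (_* h (suc i)) (nat-+ (m C i) (m C suc i)) ⟨
      nat (m C i ℕ.+ m C suc i) * h (suc i)                ≡⟨ cong (λ c → nat c * h (suc i))
                                                                   (nCk+nC[k+1]≡[n+1]C[k+1] m i) ⟩
      nat (suc m C suc i) * h (suc i)                      ∎

  ΣSub : ∀ n → (Subset n → Carrier) → Carrier
  ΣSub zero    f = f []
  ΣSub (suc n) f = ΣSub n (f ∘ (outside ∷_)) + ΣSub n (f ∘ (inside ∷_))

  ΣSub-cong : ∀ n {f g : Subset n → Carrier} → (∀ T → f T ≡ g T) → ΣSub n f ≡ ΣSub n g
  ΣSub-cong zero    f≗g = f≗g []
  ΣSub-cong (suc n) f≗g =
    cong₂ _+_ (ΣSub-cong n (f≗g ∘ (outside ∷_))) (ΣSub-cong n (f≗g ∘ (inside ∷_)))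

  ΣSub-zero : ∀ n (f : Subset n → Carrier) → (∀ T → f T ≡ 0#) → ΣSub n f ≡ 0#
  ΣSub-zero zero    f f≡0 = f≡0 []
  ΣSub-zero (suc n) f f≡0 =
    trans (cong₂ _+_ (ΣSub-zero n _ (f≡0 ∘ (outside ∷_))) (ΣSub-zero n _ (f≡0 ∘ (inside ∷_))))
          (+-identityˡ 0#)

  ΣSub-+ : ∀ n (f g : Subset n → Carrier) → ΣSub n (λ T → f T + g T) ≡ ΣSub n f + ΣSub n g
  ΣSub-+ zero    f g = refl
  ΣSub-+ (suc n) f g = trans (cong₂ _+_ (ΣSub-+ n _ _) (ΣSub-+ n _ _)) (+-interchange _ _ _ _)

  ΣSub-*ˡ : ∀ n c (f : Subset n → Carrier) → ΣSub n (λ T → c * f T) ≡ c * ΣSub n f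
  ΣSub-*ˡ zero    c f = refl
  ΣSub-*ˡ (suc n) c f = trans (cong₂ _+_ (ΣSub-*ˡ n c _) (ΣSub-*ˡ n c _)) (sym (distribˡ c _ _))

  ∑-ΣSub : ∀ m n (f : Fin m → Subset n → Carrier) →
           ∑[ i < m ] ΣSub n (f i) ≡ ΣSub n (λ T → ∑[ i < m ] f i T)
  ∑-ΣSub zero    n f = sym (ΣSub-zero n _ (λ T → refl))
  ∑-ΣSub (suc m) n f =
    trans (cong (ΣSub n (f Fin.zero) +_) (∑-ΣSub m n (f ∘ Fin.suc))) (sym (ΣSub-+ n _ _))

  ΣSub-comm : ∀ m n (f : Subset m → Subset n → Carrier) →
              ΣSub m (λ S → ΣSub n (f S)) ≡ ΣSub n (λ T → ΣSub m (λ S → f S T))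
  ΣSub-comm zero    n f = refl
  ΣSub-comm (suc m) n f =
    trans (cong₂ _+_ (ΣSub-comm m n _) (ΣSub-comm m n _)) (sym (ΣSub-+ n _ _))

  -- Summing g(|T|) over the interval P ⊆ T ⊆ Q groups the terms by size:
  -- there are C(gap P Q, i) sets T of size i + |P| in the interval.
  ΣSub-interval : ∀ n (P Q : Subset n) → P ⊆ Q → ∀ (g : ℕ → Carrier) →
    ΣSub n (λ T → χ (does (P ⊆? T) ∧ does (T ⊆? Q)) * g ∣ T ∣)
      ≡ Bin (gap P Q) (λ i → g (i ℕ.+ ∣ P ∣))
  ΣSub-interval zero [] [] _ g = begin
    1# * g 0              ≡⟨ cong (_* g 0) (+-identityʳ 1#) ⟨
    (1# + 0#) * g 0       ≡⟨ +-identityʳ _ ⟨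
    (1# + 0#) * g 0 + 0#  ∎
  -- a point outside Q is outside T
  ΣSub-interval (suc n) (outside ∷ P) (outside ∷ Q) P⊆Q g =
    trans (cong₂ _+_ (ΣSub-interval n P Q (drop-∷-⊆ P⊆Q) g) (ΣSub-zero n _ not-below))
          (+-identityʳ _)
    where
    not-below : ∀ T → χ (does (P ⊆? T) ∧ false) * g (suc ∣ T ∣) ≡ 0#
    not-below T = trans (cong (λ c → χ c * g (suc ∣ T ∣)) (∧-zeroʳ (does (P ⊆? T)))) (zeroˡ _)
  -- a point of P is in T, which shifts the size by one
  ΣSub-interval (suc n) (inside ∷ P) (inside ∷ Q) P⊆Q g =
    trans (cong₂ _+_ (ΣSub-zero n _ (λ T → zeroˡ _))
                     (ΣSub-interval n P Q (drop-∷-⊆ P⊆Q) (g ∘ suc)))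
          (trans (+-identityˡ _) (Σℕ-cong (suc (gap P Q)) shift))
    where
    shift : ∀ i → nat (gap P Q C i) * g (suc (i ℕ.+ ∣ P ∣)) ≡ nat (gap P Q C i) * g (i ℕ.+ suc ∣ P ∣)
    shift i = cong (λ m → nat (gap P Q C i) * g m) (sym (+-suc i ∣ P ∣))
  -- a free point of the interval may or may not be in T: Pascal's rule
  ΣSub-interval (suc n) (outside ∷ P) (inside ∷ Q) P⊆Q g =
    trans (cong₂ _+_ (ΣSub-interval n P Q (drop-∷-⊆ P⊆Q) g)
                     (ΣSub-interval n P Q (drop-∷-⊆ P⊆Q) (g ∘ suc)))
          (Bin-pascal (gap P Q) (λ i → g (i ℕ.+ ∣ P ∣)))
  ΣSub-interval (suc n) (inside ∷ P) (outside ∷ Q) P⊆Q g with () ← P⊆Q here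

  ΣSub-below : ∀ n (Q : Subset n) (g : ℕ → Carrier) →
    ΣSub n (λ T → χ (does (T ⊆? Q)) * g ∣ T ∣) ≡ Bin ∣ Q ∣ g
  ΣSub-below n Q g = begin
    ΣSub n (λ T → χ (does (T ⊆? Q)) * g ∣ T ∣)                ≡⟨ ΣSub-cong n from-∅ ⟨
    ΣSub n (λ T → χ (does (⊥ ⊆? T) ∧ does (T ⊆? Q)) * g ∣ T ∣) ≡⟨ ΣSub-interval n ⊥ Q ⊥⊆ g ⟩
    Bin (gap ⊥ Q) g∅                                           ≡⟨ cong (λ m → Bin m g∅) (gap-⊥ Q) ⟩
    Bin (∣ Q ∣) g∅                                             ≡⟨ Σℕ-cong (suc ∣ Q ∣) drop-∅ ⟩
    Bin (∣ Q ∣) g                                              ∎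
    where
    g∅ : ℕ → Carrier
    g∅ i = g (i ℕ.+ ∣ ⊥ {n = n} ∣)
    from-∅ : ∀ T → χ (does (⊥ ⊆? T) ∧ does (T ⊆? Q)) * g ∣ T ∣ ≡ χ (does (T ⊆? Q)) * g ∣ T ∣
    from-∅ T = cong (λ c → χ (c ∧ does (T ⊆? Q)) * g ∣ T ∣) (dec-true (⊥ ⊆? T) ⊥⊆)
    drop-∅ : ∀ i → nat (∣ Q ∣ C i) * g∅ i ≡ nat (∣ Q ∣ C i) * g i
    drop-∅ i = cong (λ m → nat (∣ Q ∣ C i) * g m) (trans (cong (i ℕ.+_) (∣⊥∣≡0 n)) (+-identityʳℕ i))

  ∑-others : ∀ n (β : Fin n) (f : Fin n → Carrier) →
    ∑[ i < n ] (χ (not (does (i ≟ β))) * f i) + f β ≡ ∑[ i < n ] f i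
  ∑-others (suc n) Fin.zero f = begin
    (0# * f₀ + rest) + f₀        ≡⟨ cong (λ z → (z + rest) + f₀) (zeroˡ f₀) ⟩
    (0# + rest) + f₀             ≡⟨ cong (_+ f₀) (+-identityˡ rest) ⟩
    rest + f₀                    ≡⟨ cong (_+ f₀) (sum-cong-≗ {n} (*-identityˡ ∘ f ∘ Fin.suc)) ⟩
    ∑[ i < n ] f (Fin.suc i) + f₀ ≡⟨ +-comm _ f₀ ⟩
    f₀ + ∑[ i < n ] f (Fin.suc i) ∎
    where
    f₀ = f Fin.zero
    rest = ∑[ i < n ] (1# * f (Fin.suc i))
  ∑-others (suc n) (Fin.suc β) f = begin
    (1# * f₀ + ∑[ i < n ] (χ (not (does (i ≟ β))) * f (Fin.suc i))) + f (Fin.suc β)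
      ≡⟨ +-assoc _ _ _ ⟩
    1# * f₀ + (∑[ i < n ] (χ (not (does (i ≟ β))) * f (Fin.suc i)) + f (Fin.suc β))
      ≡⟨ cong₂ _+_ (*-identityˡ f₀) (∑-others n β (f ∘ Fin.suc)) ⟩
    f₀ + ∑[ i < n ] f (Fin.suc i) ∎
    where f₀ = f Fin.zero

  ∑-single : ∀ n (β : Fin n) (f : Fin n → Carrier) → (∀ i → i ≢ β → f i ≡ 0#) →
             ∑[ i < n ] f i ≡ f β
  ∑-single n β f f≡0 = begin
    ∑[ i < n ] f i                                  ≡⟨ ∑-others n β f ⟨
    ∑[ i < n ] (χ (not (does (i ≟ β))) * f i) + f β ≡⟨ cong (_+ f β) (sum-zero n _ off-β) ⟩
    0# + f β                                        ≡⟨ +-identityˡ (f β) ⟩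
    f β                                             ∎
    where
    off-β : ∀ i → χ (not (does (i ≟ β))) * f i ≡ 0#
    off-β i with i ≟ β
    ... | yes _   = zeroˡ (f i)
    ... | no  i≢β = trans (cong (1# *_) (f≡0 i i≢β)) (zeroʳ 1#)

  nat-∣tabulate∣ : ∀ n (f : Fin n → Bool) → nat ∣ tabulate f ∣ ≡ ∑[ i < n ] χ (f i)
  nat-∣tabulate∣ zero    f = refl
  nat-∣tabulate∣ (suc n) f with f Fin.zero
  ... | true  = cong (1# +_) (nat-∣tabulate∣ n (f ∘ Fin.suc))
  ... | false = trans (nat-∣tabulate∣ n (f ∘ Fin.suc)) (sym (+-identityˡ _))

module AlternatingSums (R : CommutativeRing 0ℓ 0ℓ)
                       (≈⇒≡ : ∀ {x y} → CommutativeRing._≈_ R x y → x ≡ y) where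

  open CommutativeRing R using (_+_; _*_; -_; 0#; 1#; Carrier; commutativeSemiring)
  private module R = CommutativeRing R
  open FiniteSums commutativeSemiring ≈⇒≡ public

  sgn : ℕ → Carrier
  sgn zero    = 1#
  sgn (suc n) = - sgn n

  ΣSub-alternating : ∀ n (D : Subset n) →
    ΣSub n (λ I → χ (does (I ⊆? D)) * sgn ∣ I ∣) ≡ χ (does (D ⊆? ⊥))
  ΣSub-alternating zero    []            = *-identityˡ 1#
  ΣSub-alternating (suc n) (outside ∷ D) =
    trans (cong₂ _+_ (ΣSub-alternating n D) (ΣSub-zero n _ (λ I → zeroˡ _))) (+-identityʳ _)
  ΣSub-alternating (suc n) (inside  ∷ D) =
    trans (sym (ΣSub-+ n _ _)) (ΣSub-zero n _ cancels)
    where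
    -- adding the new point to I flips the sign
    cancels : ∀ I → χ (does (I ⊆? D)) * sgn ∣ I ∣ + χ (does (I ⊆? D)) * - sgn ∣ I ∣ ≡ 0#
    cancels I = begin
      χ (does (I ⊆? D)) * sgn ∣ I ∣ + χ (does (I ⊆? D)) * - sgn ∣ I ∣ ≡⟨ distribˡ _ _ _ ⟨
      χ (does (I ⊆? D)) * (sgn ∣ I ∣ + - sgn ∣ I ∣)                  ≡⟨ cong (χ (does (I ⊆? D)) *_)
                                                                           (≈⇒≡ (R.-‿inverseʳ _)) ⟩
      χ (does (I ⊆? D)) * 0#                                        ≡⟨ zeroʳ _ ⟩
      0#                                                            ∎

module ℕ-Sums = FiniteSums ℕ-semiring (λ e → e)

nat-ℕ : ∀ n → ℕ-Sums.nat n ≡ n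
nat-ℕ zero    = refl
nat-ℕ (suc n) = cong suc (nat-ℕ n)

count-interval : ∀ v t (J Q : Subset v) → J ⊆ Q → ∣ J ∣ ≤ t →
  ℕ-Sums.ΣSub v (λ T → ℕ-Sums.χ (does (J ⊆? T) ∧ does (T ⊆? Q)) ℕ.* ℕ-Sums.χ (∣ T ∣ ≡ᵇ t))
    ≡ (∣ Q ∣ ∸ ∣ J ∣) C (t ∸ ∣ J ∣)
count-interval v t J Q J⊆Q ∣J∣≤t = begin
  ΣSub v (λ T → χ (does (J ⊆? T) ∧ does (T ⊆? Q)) ℕ.* χ (∣ T ∣ ≡ᵇ t))
    ≡⟨ ΣSub-interval v J Q J⊆Q (λ m → χ (m ≡ᵇ t)) ⟩
  Σℕ (suc g) (λ i → nat (g C i) ℕ.* χ (i ℕ.+ ∣ J ∣ ≡ᵇ t))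
    ≡⟨ Σℕ-cong (suc g) reindex ⟩
  Σℕ (suc g) (λ i → (g C i) ℕ.* χ (i ≡ᵇ t ∸ ∣ J ∣))
    ≡⟨ Σℕ-select (suc g) (t ∸ ∣ J ∣) (g C_) (λ i g<i → k>n⇒nCk≡0 g<i) ⟩
  g C (t ∸ ∣ J ∣)
    ≡⟨ cong (_C (t ∸ ∣ J ∣)) g≡∣Q∣-∣J∣ ⟩
  (∣ Q ∣ ∸ ∣ J ∣) C (t ∸ ∣ J ∣) ∎
  where
  open ℕ-Sums
  g = gap J Q
  reindex : ∀ i → nat (g C i) ℕ.* χ (i ℕ.+ ∣ J ∣ ≡ᵇ t) ≡ (g C i) ℕ.* χ (i ≡ᵇ t ∸ ∣ J ∣)
  reindex i = cong₂ (λ c e → c ℕ.* χ e) (nat-ℕ (g C i)) (≡ᵇ-shift i ∣ J ∣ t ∣J∣≤t)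
  g≡∣Q∣-∣J∣ : g ≡ ∣ Q ∣ ∸ ∣ J ∣
  g≡∣Q∣-∣J∣ = trans (sym (m+n∸n≡m g ∣ J ∣)) (cong (_∸ ∣ J ∣) (gap-size J Q J⊆Q))

module BlockCounting (t v k b : ℕ) (t≤k : t ≤ k) (X : Fin b → Subset v)
                     (D : IsDesign t v k b X) where

  open IsDesign D
  open ℕ-Sums

  Λ : Subset v → ℕ
  Λ J = ∑[ i < b ] χ (does (J ⊆? X i))

  Λ-tset : ∀ T → ∣ T ∣ ≡ t → Λ T ≡ 1
  Λ-tset T ∣T∣≡t with covered T ∣T∣≡t
  ... | i₀ , T⊆Xi₀ = trans (∑-single b i₀ _ other) (cong χ (dec-true (T ⊆? X i₀) T⊆Xi₀))
    where
    other : ∀ i → i ≢ i₀ → χ (does (T ⊆? X i)) ≡ 0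
    other i i≢i₀ with T ⊆? X i
    ... | yes T⊆Xi = ⊥-elim (i≢i₀ (unique T ∣T∣≡t i i₀ T⊆Xi T⊆Xi₀))
    ... | no  _    = refl

  large-set-unique : ∀ J → t ≤ ∣ J ∣ → ∀ i i′ → J ⊆ X i → J ⊆ X i′ → i ≡ i′
  large-set-unique J t≤∣J∣ i i′ J⊆Xi J⊆Xi′ with subset-of-size J t t≤∣J∣
  ... | T , T⊆J , ∣T∣≡t = unique T ∣T∣≡t i i′ (⊆-trans T⊆J J⊆Xi) (⊆-trans T⊆J J⊆Xi′)

  χ-rearrange : ∀ a c e → χ (a ∧ c) ℕ.* χ e ≡ χ a ℕ.* χ e ℕ.* χ c
  χ-rearrange true  true  true  = refl
  χ-rearrange true  true  false = refl
  χ-rearrange true  false true  = refl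
  χ-rearrange true  false false = refl
  χ-rearrange false c     e     = refl

  tsets-in-block : ∀ J → ∣ J ∣ ≤ t → ∀ i →
    χ (does (J ⊆? X i)) ℕ.* ((k ∸ ∣ J ∣) C (t ∸ ∣ J ∣))
      ≡ ΣSub v (λ T → χ (does (J ⊆? T)) ℕ.* χ (∣ T ∣ ≡ᵇ t) ℕ.* χ (does (T ⊆? X i)))
  tsets-in-block J ∣J∣≤t i with J ⊆? X i
  ... | yes J⊆Xi = begin
    1 ℕ.* ((k ∸ ∣ J ∣) C (t ∸ ∣ J ∣))          ≡⟨ *-identityˡℕ _ ⟩
    (k ∸ ∣ J ∣) C (t ∸ ∣ J ∣)                   ≡⟨ cong (λ m → (m ∸ ∣ J ∣) C (t ∸ ∣ J ∣))
                                                        (blockSize i) ⟨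
    (∣ X i ∣ ∸ ∣ J ∣) C (t ∸ ∣ J ∣)             ≡⟨ count-interval v t J (X i) J⊆Xi ∣J∣≤t ⟨
    ΣSub v (λ T → χ (does (J ⊆? T) ∧ does (T ⊆? X i)) ℕ.* χ (∣ T ∣ ≡ᵇ t))
      ≡⟨ ΣSub-cong v (λ T → χ-rearrange (does (J ⊆? T)) (does (T ⊆? X i)) (∣ T ∣ ≡ᵇ t)) ⟩
    ΣSub v (λ T → χ (does (J ⊆? T)) ℕ.* χ (∣ T ∣ ≡ᵇ t) ℕ.* χ (does (T ⊆? X i))) ∎
  ... | no J⊈Xi = sym (ΣSub-zero v _ vanish)
    where
    vanish : ∀ T → χ (does (J ⊆? T)) ℕ.* χ (∣ T ∣ ≡ᵇ t) ℕ.* χ (does (T ⊆? X i)) ≡ 0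
    vanish T with J ⊆? T | T ⊆? X i
    ... | yes J⊆T | yes T⊆Xi = ⊥-elim (J⊈Xi (⊆-trans J⊆T T⊆Xi))
    ... | yes _   | no  _    = *-zeroʳℕ (1 ℕ.* χ (∣ T ∣ ≡ᵇ t))
    ... | no  _   | _        = refl

  blocks-of-tset : ∀ J T →
    χ (does (J ⊆? T)) ℕ.* χ (∣ T ∣ ≡ᵇ t) ℕ.* Λ T
      ≡ χ (does (J ⊆? T) ∧ does (T ⊆? ⊤)) ℕ.* χ (∣ T ∣ ≡ᵇ t)
  blocks-of-tset J T
    rewrite dec-true (T ⊆? ⊤) ⊆⊤ | ∧-identityʳ (does (J ⊆? T)) with ∣ T ∣ ≡ᵇ t in ∣T∣≟t
  ... | true  = begin
    χ (does (J ⊆? T)) ℕ.* 1 ℕ.* Λ T ≡⟨ cong (χ (does (J ⊆? T)) ℕ.* 1 ℕ.*_) (Λ-tset T ∣T∣≡t) ⟩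
    χ (does (J ⊆? T)) ℕ.* 1 ℕ.* 1   ≡⟨ *-identityʳℕ _ ⟩
    χ (does (J ⊆? T)) ℕ.* 1         ∎
    where ∣T∣≡t = ≡ᵇ⇒≡ ∣ T ∣ t (Equivalence.from T-≡ ∣T∣≟t)
  ... | false = begin
    χ (does (J ⊆? T)) ℕ.* 0 ℕ.* Λ T ≡⟨ cong (ℕ._* Λ T) (*-zeroʳℕ (χ (does (J ⊆? T)))) ⟩
    0                               ≡⟨ *-zeroʳℕ (χ (does (J ⊆? T))) ⟨
    χ (does (J ⊆? T)) ℕ.* 0         ∎

  -- Double counting pairs (T, block) with J ⊆ T ⊆ block and |T| = t:
  -- Λ(J) C(k - |J|, t - |J|) = C(v - |J|, t - |J|).
  double-count : ∀ J → ∣ J ∣ ≤ t →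
    Λ J ℕ.* ((k ∸ ∣ J ∣) C (t ∸ ∣ J ∣)) ≡ (v ∸ ∣ J ∣) C (t ∸ ∣ J ∣)
  double-count J ∣J∣≤t = begin
    Λ J ℕ.* c
      ≡⟨ ∑-*ʳ b c _ ⟩
    ∑[ i < b ] (χ (does (J ⊆? X i)) ℕ.* c)
      ≡⟨ sum-cong-≗ {b} (tsets-in-block J ∣J∣≤t) ⟩
    ∑[ i < b ] ΣSub v (λ T → through T ℕ.* χ (does (T ⊆? X i)))
      ≡⟨ ∑-ΣSub b v _ ⟩
    ΣSub v (λ T → ∑[ i < b ] (through T ℕ.* χ (does (T ⊆? X i))))
      ≡⟨ ΣSub-cong v (λ T → ∑-*ˡ b (through T) _) ⟨
    ΣSub v (λ T → through T ℕ.* Λ T)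
      ≡⟨ ΣSub-cong v (blocks-of-tset J) ⟩
    ΣSub v (λ T → χ (does (J ⊆? T) ∧ does (T ⊆? ⊤)) ℕ.* χ (∣ T ∣ ≡ᵇ t))
      ≡⟨ count-interval v t J ⊤ ⊆⊤ ∣J∣≤t ⟩
    (∣ ⊤ {v} ∣ ∸ ∣ J ∣) C (t ∸ ∣ J ∣)
      ≡⟨ cong (λ m → (m ∸ ∣ J ∣) C (t ∸ ∣ J ∣)) (∣⊤∣≡n v) ⟩
    (v ∸ ∣ J ∣) C (t ∸ ∣ J ∣) ∎
    where
    c = (k ∸ ∣ J ∣) C (t ∸ ∣ J ∣)
    through : Subset v → ℕ
    through T = χ (does (J ⊆? T)) ℕ.* χ (∣ T ∣ ≡ᵇ t)

  r-counts-blocks : ∀ J → ∣ J ∣ ≤ t → r t v k ∣ J ∣ ≡ Λ J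
  r-counts-blocks J ∣J∣≤t = begin
    divℕ ((v ∸ ∣ J ∣) C (t ∸ ∣ J ∣)) c  ≡⟨ cong (λ m → divℕ m c) (double-count J ∣J∣≤t) ⟨
    divℕ (Λ J ℕ.* c) c                  ≡⟨ divℕ-cancel (Λ J) c c>0 ⟩
    Λ J                                 ∎
    where
    c = (k ∸ ∣ J ∣) C (t ∸ ∣ J ∣)
    c>0 = C-positive (k ∸ ∣ J ∣) (t ∸ ∣ J ∣) (∸-monoˡ-≤ ∣ J ∣ t≤k)

-- The integers are imported only now: their constructor +_ would clash with
-- the semiring sections (x +_) used above.
open import Data.Integer as ℤ using (ℤ; +_)
import Data.Integer.Properties as ZP
open import Data.Integer.Tactic.RingSolver using (solve-∀)
open import Data.Integer.Properties using () renaming (+-*-commutativeRing to ℤ-ring)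

module ℤ-Sums = AlternatingSums ℤ-ring (λ e → e)

nat-ℤ : ∀ n → ℤ-Sums.nat n ≡ + n
nat-ℤ zero    = refl
nat-ℤ (suc n) = cong (λ z → + 1 ℤ.+ z) (nat-ℤ n)

sgn-ℤ : ∀ n → ℤ-Sums.sgn n ≡ signℤ n
sgn-ℤ zero    = refl
sgn-ℤ (suc n) = cong ℤ.-_ (sgn-ℤ n)

+-∑ : ∀ n (f : Fin n → ℕ) → + (ℕ-Sums.sum f) ≡ ℤ-Sums.sum (λ i → + f i)
+-∑ zero    f = refl
+-∑ (suc n) f = trans (ZP.pos-+ (f Fin.zero) _) (cong (λ z → + f Fin.zero ℤ.+ z) (+-∑ n (f ∘ Fin.suc)))

+-χ : ∀ a → + ℕ-Sums.χ a ≡ ℤ-Sums.χ a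
+-χ true  = refl
+-χ false = refl

neg-Σℕ : ∀ n f → ℤ.- ℤ-Sums.Σℕ n f ≡ ℤ-Sums.Σℕ n (λ i → ℤ.- f i)
neg-Σℕ zero    f = refl
neg-Σℕ (suc n) f = trans (ZP.neg-distrib-+ (f 0) _) (cong (λ z → ℤ.- f 0 ℤ.+ z) (neg-Σℕ n (f ∘ suc)))

x+[y+z]≡y⇒x≡-z : ∀ {x y z} → x ℤ.+ (y ℤ.+ z) ≡ y → x ≡ ℤ.- z
x+[y+z]≡y⇒x≡-z {x} {y} {z} eq = begin
  x                                     ≡⟨ regroup x y z ⟩
  x ℤ.+ (y ℤ.+ z) ℤ.- y ℤ.- z           ≡⟨ cong (λ w → w ℤ.- y ℤ.- z) eq ⟩
  y ℤ.- y ℤ.- z                         ≡⟨ collapse y z ⟩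
  ℤ.- z                                 ∎
  where
  regroup : ∀ x y z → x ≡ x ℤ.+ (y ℤ.+ z) ℤ.- y ℤ.- z
  regroup = solve-∀
  collapse : ∀ y z → y ℤ.- y ℤ.- z ≡ ℤ.- z
  collapse = solve-∀

-- For the player holding B = X β: the blocks other than B meeting a set
-- I ⊆ B number e(|I|), by inclusion–exclusion over the points of I.
module MeetingBlocks (t v k b : ℕ) (t≤k : t ≤ k) (X : Fin b → Subset v)
                     (D : IsDesign t v k b X) (β : Fin b) where

  open BlockCounting t v k b t≤k X D using (Λ; r-counts-blocks; large-set-unique)
  open ℤ-Sums
    using (χ; χ-∧; nat; sgn; sum-syntax; sum-cong-≗; sum-zero; ∑-+; ∑-*ˡ; ∑-others;
           ∑-ΣSub; ΣSub; ΣSub-cong; ΣSub-*ˡ; ΣSub-alternating; ΣSub-below; Bin;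
           Σℕ; Σℕ-truncate; Σℕ-applyUpTo; nat-∣tabulate∣)

  B : Subset v
  B = X β

  other : Fin b → Bool
  other i = not (does (i ≟ β))

  N : Subset v → ℤ
  N J = ∑[ i < b ] (χ (other i) ℤ.* χ (does (J ⊆? X i)))

  -- The value of N on a j-subset of B: r_j - 1 for j < t and 0 otherwise.
  λ′ : ℕ → ℤ
  λ′ j with j <? t
  ... | yes _ = + r t v k j ℤ.- + 1
  ... | no  _ = + 0

  N-on-B : ∀ J → J ⊆ B → N J ≡ λ′ ∣ J ∣
  N-on-B J J⊆B with ∣ J ∣ <? t
  ... | yes ∣J∣<t = subtract-one (begin
    N J ℤ.+ + 1                                       ≡⟨ cong (λ c → N J ℤ.+ χ c) (dec-true (J ⊆? B) J⊆B) ⟨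
    N J ℤ.+ χ (does (J ⊆? B))                         ≡⟨ ∑-others b β (λ i → χ (does (J ⊆? X i))) ⟩
    ∑[ i < b ] (χ (does (J ⊆? X i)))                  ≡⟨ sum-cong-≗ {b} (λ i → +-χ (does (J ⊆? X i))) ⟨
    ∑[ i < b ] (+ ℕ-Sums.χ (does (J ⊆? X i)))         ≡⟨ +-∑ b _ ⟨
    + Λ J                                             ≡⟨ cong +_ (r-counts-blocks J (<⇒≤ ∣J∣<t)) ⟨
    + r t v k ∣ J ∣                                   ∎)
    where
    subtract-one : ∀ {x y} → x ℤ.+ + 1 ≡ y → x ≡ y ℤ.- + 1
    subtract-one {x} refl = sym (trans (ZP.+-assoc x (+ 1) (ℤ.- + 1)) (ZP.+-identityʳ x))
  ... | no ∣J∣≮t = sum-zero b _ vanish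
    where
    vanish : ∀ i → χ (other i) ℤ.* χ (does (J ⊆? X i)) ≡ + 0
    vanish i with i ≟ β
    ... | yes _ = ZP.*-zeroˡ (χ (does (J ⊆? X i)))
    ... | no i≢β with J ⊆? X i
    ...   | yes J⊆Xi = ⊥-elim (i≢β (large-set-unique J (≮⇒≥ ∣J∣≮t) i β J⊆Xi J⊆B))
    ...   | no  _    = refl

  meets-or-avoids : ∀ I →
    ∑[ i < b ] (χ (other i ∧ not (does (X i ∩ I ⊆? ⊥))))
      ℤ.+ ∑[ i < b ] (χ (other i) ℤ.* χ (does (X i ∩ I ⊆? ⊥))) ≡ N ⊥
  meets-or-avoids I = trans (sym (∑-+ b meets avoids)) (sum-cong-≗ {b} split)
    where
    meets avoids : Fin b → ℤ
    meets  i = χ (other i ∧ not (does (X i ∩ I ⊆? ⊥)))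
    avoids i = χ (other i) ℤ.* χ (does (X i ∩ I ⊆? ⊥))
    χ-split : ∀ o a → χ (o ∧ not a) ℤ.+ χ o ℤ.* χ a ≡ χ o ℤ.* + 1
    χ-split true  true  = refl
    χ-split true  false = refl
    χ-split false true  = refl
    χ-split false false = refl
    split : ∀ i → meets i ℤ.+ avoids i ≡ χ (other i) ℤ.* χ (does (⊥ ⊆? X i))
    split i = trans (χ-split (other i) (does (X i ∩ I ⊆? ⊥)))
                    (cong (λ c → χ (other i) ℤ.* χ c) (sym (dec-true (⊥ ⊆? X i) ⊥⊆)))

  -- Inclusion–exclusion: for I ⊆ B the blocks other than B avoiding I number
  -- ∑_{J ⊆ I} (-1)^{|J|} N(J) = ∑_j C(|I|, j) (-1)^j λ′(j).
  avoiding : ∀ I → I ⊆ B →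
    ∑[ i < b ] (χ (other i) ℤ.* χ (does (X i ∩ I ⊆? ⊥))) ≡ Bin ∣ I ∣ (λ j → sgn j ℤ.* λ′ j)
  avoiding I I⊆B = begin
    ∑[ i < b ] (χ (other i) ℤ.* χ (does (X i ∩ I ⊆? ⊥)))
      ≡⟨ sum-cong-≗ {b} (λ i → cong (χ (other i) ℤ.*_) (ΣSub-alternating v (X i ∩ I))) ⟨
    ∑[ i < b ] (χ (other i) ℤ.* ΣSub v (λ J → χ (does (J ⊆? X i ∩ I)) ℤ.* sgn ∣ J ∣))
      ≡⟨ sum-cong-≗ {b} (λ i → ΣSub-*ˡ v (χ (other i)) _) ⟨
    ∑[ i < b ] ΣSub v (λ J → χ (other i) ℤ.* (χ (does (J ⊆? X i ∩ I)) ℤ.* sgn ∣ J ∣))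
      ≡⟨ ∑-ΣSub b v _ ⟩
    ΣSub v (λ J → ∑[ i < b ] (χ (other i) ℤ.* (χ (does (J ⊆? X i ∩ I)) ℤ.* sgn ∣ J ∣)))
      ≡⟨ ΣSub-cong v (λ J → sum-cong-≗ {b} (factor J)) ⟩
    ΣSub v (λ J → ∑[ i < b ] (coeff J ℤ.* (χ (other i) ℤ.* χ (does (J ⊆? X i)))))
      ≡⟨ ΣSub-cong v (λ J → ∑-*ˡ b (coeff J) (λ i → χ (other i) ℤ.* χ (does (J ⊆? X i)))) ⟨
    ΣSub v (λ J → coeff J ℤ.* N J)
      ≡⟨ ΣSub-cong v size-only ⟩
    ΣSub v (λ J → χ (does (J ⊆? I)) ℤ.* (sgn ∣ J ∣ ℤ.* λ′ ∣ J ∣))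
      ≡⟨ ΣSub-below v I (λ j → sgn j ℤ.* λ′ j) ⟩
    Bin ∣ I ∣ (λ j → sgn j ℤ.* λ′ j) ∎
    where
    coeff : Subset v → ℤ
    coeff J = χ (does (J ⊆? I)) ℤ.* sgn ∣ J ∣
    rearrange : ∀ o a c s → o ℤ.* ((a ℤ.* c) ℤ.* s) ≡ (c ℤ.* s) ℤ.* (o ℤ.* a)
    rearrange = solve-∀
    factor : ∀ J i → χ (other i) ℤ.* (χ (does (J ⊆? X i ∩ I)) ℤ.* sgn ∣ J ∣)
                     ≡ coeff J ℤ.* (χ (other i) ℤ.* χ (does (J ⊆? X i)))
    factor J i rewrite does-⊆?-∩ J (X i) I | χ-∧ (does (J ⊆? X i)) (does (J ⊆? I)) =
      rearrange (χ (other i)) (χ (does (J ⊆? X i))) (χ (does (J ⊆? I))) (sgn ∣ J ∣)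
    size-only : ∀ J → coeff J ℤ.* N J ≡ χ (does (J ⊆? I)) ℤ.* (sgn ∣ J ∣ ℤ.* λ′ ∣ J ∣)
    size-only J with J ⊆? I
    ... | yes J⊆I = trans (ZP.*-assoc (+ 1) (sgn ∣ J ∣) (N J))
                          (cong (λ n → + 1 ℤ.* (sgn ∣ J ∣ ℤ.* n)) (N-on-B J (⊆-trans J⊆I I⊆B)))
    ... | no  _   = trans (cong (ℤ._* N J) (ZP.*-zeroˡ (sgn ∣ J ∣))) (ZP.*-zeroˡ (N J))

  meeting : Subset v → Subset b
  meeting I = setOf (λ i → ¬? (i ≟ β) ×-dec ¬? (X i ∩ I ⊆? ⊥))

  #meeting : Subset v → ℤ
  #meeting I = ∑[ i < b ] (χ (other i ∧ not (does (X i ∩ I ⊆? ⊥))))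

  H : ℕ → ℤ
  H j = sgn j ℤ.* λ′ j

  -- Meeting plus avoiding blocks are all the blocks other than B, N(∅) = H 0.
  meeting-balance : ∀ I → I ⊆ B → #meeting I ℤ.+ Bin ∣ I ∣ H ≡ H 0
  meeting-balance I I⊆B = begin
    #meeting I ℤ.+ Bin (∣ I ∣) H          ≡⟨ cong (λ w → #meeting I ℤ.+ w) (avoiding I I⊆B) ⟨
    #meeting I ℤ.+ ∑[ i < b ] (χ (other i) ℤ.* χ (does (X i ∩ I ⊆? ⊥)))
                                          ≡⟨ meets-or-avoids I ⟩
    N ⊥                                   ≡⟨ N-on-B ⊥ ⊥⊆ ⟩
    λ′ ∣ ⊥ {v} ∣                          ≡⟨ cong λ′ (∣⊥∣≡0 v) ⟩
    λ′ 0                                  ≡⟨ ZP.*-identityˡ (λ′ 0) ⟨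
    H 0                                   ∎

  e-term : ℕ → ℕ → ℤ
  e-term m j = signℤ (suc (suc j)) ℤ.* + (m C suc j) ℤ.* (+ r t v k (suc j) ℤ.- + 1)

  term : ℕ → ℕ → ℤ
  term m j = ℤ.- (nat (m C suc j) ℤ.* H (suc j))

  term-below-t : ∀ m j → j < t ∸ 1 → term m j ≡ e-term m j
  term-below-t m j j<t-1 with suc j <? t
  ... | no  j≮t = ⊥-elim (j≮t (succ-<-∸1 t j j<t-1))
  ... | yes _   = begin
    ℤ.- (nat (m C suc j) ℤ.* (sgn (suc j) ℤ.* y))    ≡⟨ cong₂ (λ c s → ℤ.- (c ℤ.* (s ℤ.* y)))
                                                                (nat-ℤ (m C suc j)) (sgn-ℤ (suc j)) ⟩
    ℤ.- (+ (m C suc j) ℤ.* (signℤ (suc j) ℤ.* y))    ≡⟨ move-sign (+ (m C suc j)) (signℤ (suc j)) y ⟩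
    ℤ.- signℤ (suc j) ℤ.* + (m C suc j) ℤ.* y        ∎
    where
    y = + r t v k (suc j) ℤ.- + 1
    move-sign : ∀ c s y → ℤ.- (c ℤ.* (s ℤ.* y)) ≡ ℤ.- s ℤ.* c ℤ.* y
    move-sign = solve-∀

  term-from-t : ∀ m j → t ∸ 1 ≤ j → term m j ≡ + 0
  term-from-t m j t-1≤j with suc j <? t
  ... | yes j<t = ⊥-elim (<⇒≱ j<t (∸1-≤-succ t j t-1≤j))
  ... | no  _   = cong ℤ.-_ (trans (cong (nat (m C suc j) ℤ.*_) (ZP.*-zeroʳ (sgn (suc j))))
                                   (ZP.*-zeroʳ (nat (m C suc j))))

  meeting-size : ∀ I → I ⊆ B → + ∣ meeting I ∣ ≡ e t v k ∣ I ∣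
  meeting-size I I⊆B = begin
    + ∣ meeting I ∣                              ≡⟨ nat-ℤ ∣ meeting I ∣ ⟨
    nat ∣ meeting I ∣                            ≡⟨ nat-∣tabulate∣ b _ ⟩
    #meeting I                                   ≡⟨ x+[y+z]≡y⇒x≡-z balance ⟩
    ℤ.- Σℕ m higher                              ≡⟨ neg-Σℕ m higher ⟩
    Σℕ m (term m)                                ≡⟨ Σℕ-truncate m (t ∸ 1) (term m) (e-term m)
                                                                 (term-below-t m) (term-from-t m) ⟩
    Σℕ (m ℕ.⊓ (t ∸ 1)) (e-term m)                ≡⟨ Σℕ-applyUpTo (m ℕ.⊓ (t ∸ 1)) (e-term m) ⟩
    e t v k m                                    ∎
    where
    m = ∣ I ∣
    higher : ℕ → ℤ
    higher j = nat (m C suc j) ℤ.* H (suc j)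
    -- Bin m H = 1 · H 0 + ∑_{j < m} C(m, j+1) H(j+1)
    balance : #meeting I ℤ.+ (H 0 ℤ.+ Σℕ m higher) ≡ H 0
    balance = trans (cong (λ h → #meeting I ℤ.+ (h ℤ.+ Σℕ m higher)) (sym (ZP.*-identityˡ (H 0))))
                    (meeting-balance I I⊆B)

open import Data.Rational as ℚ using (mkℚ)
import Data.Rational.Properties as QP
open import Data.Rational.Properties using () renaming (+-*-commutativeRing to ℚ-ring)
open import Data.Nat.Coprimality using (Coprime; 1-coprimeTo)
import Data.List.Properties as ListP
open import Data.Rational.Solver using (module +-*-Solver)

module ℚ-Sums = AlternatingSums ℚ-ring (λ e → e)

nat-ℚ : ∀ n → ℚ-Sums.nat n ≡ (+ n) ℚ./ 1
nat-ℚ zero    = refl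
nat-ℚ (suc n) = begin
  1ℚ ℚ.+ ℚ-Sums.nat n                      ≡⟨ cong (1ℚ ℚ.+_) (trans (nat-ℚ n) n/1≡mkℚ) ⟩
  1ℚ ℚ.+ mkℚ (+ n) 0 (sym-coprime n)        ≡⟨ cong (λ z → (+ 1 ℤ.+ z) ℚ./ 1) (ZP.*-identityʳ (+ n)) ⟩
  (+ suc n) ℚ./ 1                          ∎
  where
  sym-coprime : ∀ n → Coprime n 1
  sym-coprime n = Data.Nat.Coprimality.sym (1-coprimeTo n)
  n/1≡mkℚ : (+ n) ℚ./ 1 ≡ mkℚ (+ n) 0 (sym-coprime n)
  n/1≡mkℚ = QP.normalize-coprime (sym-coprime n)

sgn-ℚ : ∀ n → ℚ-Sums.sgn n ≡ signℚ n
sgn-ℚ zero    = refl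
sgn-ℚ (suc n) = cong ℚ.-_ (sgn-ℚ n)

sumℚ-++ : ∀ xs ys → sumℚ (xs List.++ ys) ≡ sumℚ xs ℚ.+ sumℚ ys
sumℚ-++ List.[]       ys = sym (QP.+-identityˡ (sumℚ ys))
sumℚ-++ (x List.∷ xs) ys = trans (cong (x ℚ.+_) (sumℚ-++ xs ys)) (sym (QP.+-assoc x _ _))

sum-allSubsets : ∀ n (f : Subset n → ℚ) → sumℚ (List.map f (allSubsets n)) ≡ ℚ-Sums.ΣSub n f
sum-allSubsets zero    f = QP.+-identityʳ (f [])
sum-allSubsets (suc n) f = begin
  sumℚ (List.map f (outs List.++ ins))                    ≡⟨ cong sumℚ (ListP.map-++ f outs ins) ⟩
  sumℚ (List.map f outs List.++ List.map f ins)           ≡⟨ sumℚ-++ (List.map f outs) _ ⟩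
  sumℚ (List.map f outs) ℚ.+ sumℚ (List.map f ins)        ≡⟨ cong₂ (λ xs ys → sumℚ xs ℚ.+ sumℚ ys)
                                                                  (ListP.map-∘ L) (ListP.map-∘ L) ⟨
  sumℚ (List.map (f ∘ (outside ∷_)) L) ℚ.+ sumℚ (List.map (f ∘ (inside ∷_)) L)
                                                          ≡⟨ cong₂ ℚ._+_ (sum-allSubsets n _) (sum-allSubsets n _) ⟩
  ℚ-Sums.ΣSub (suc n) f                                   ∎
  where
  L = allSubsets n
  outs = List.map (outside ∷_) L
  ins  = List.map (inside ∷_) L

Prob-expansion : ∀ {n} (E : Subset n → Set) (dec : ∀ σ → Dec (E σ)) p →
  Prob E dec p ≡ ℚ-Sums.ΣSub n (λ σ → weight p σ ℚ.* ℚ-Sums.χ (does (dec σ)))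
Prob-expansion {n} E dec p =
  trans (sum-allSubsets n _) (ℚ-Sums.ΣSub-cong n (λ σ → cong (weight p σ ℚ.*_) (if-χ (does (dec σ)))))
  where
  if-χ : ∀ a → (if a then 1ℚ else 0ℚ) ≡ ℚ-Sums.χ a
  if-χ true  = refl
  if-χ false = refl

none-available : ∀ p n (S : Subset n) →
  ℚ-Sums.ΣSub n (λ σ → weight p σ ℚ.* ℚ-Sums.χ (does (σ ∩ S ⊆? ⊥))) ≡ (1ℚ ℚ.- p) ^ℚ ∣ S ∣
none-available p zero    []            = QP.*-identityˡ 1ℚ
none-available p (suc n) (outside ∷ S) = begin
  ΣSub n (λ σ → (q ℚ.* weight p σ) ℚ.* none σ) ℚ.+ ΣSub n (λ σ → (p ℚ.* weight p σ) ℚ.* none σ)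
    ≡⟨ cong₂ ℚ._+_ (scaled q) (scaled p) ⟩
  q ℚ.* q ^ℚ ∣ S ∣ ℚ.+ p ℚ.* q ^ℚ ∣ S ∣  ≡⟨ QP.*-distribʳ-+ (q ^ℚ ∣ S ∣) q p ⟨
  (q ℚ.+ p) ℚ.* q ^ℚ ∣ S ∣             ≡⟨ cong (ℚ._* q ^ℚ ∣ S ∣) q+p≡1 ⟩
  1ℚ ℚ.* q ^ℚ ∣ S ∣                    ≡⟨ QP.*-identityˡ _ ⟩
  q ^ℚ ∣ S ∣                           ∎
  where
  open ℚ-Sums using (ΣSub; ΣSub-cong; ΣSub-*ˡ; χ)
  q = 1ℚ ℚ.- p
  none = λ σ → χ (does (σ ∩ S ⊆? ⊥))
  scaled : ∀ c → ΣSub n (λ σ → (c ℚ.* weight p σ) ℚ.* none σ) ≡ c ℚ.* q ^ℚ ∣ S ∣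
  scaled c = trans (ΣSub-cong n (λ σ → QP.*-assoc c _ _))
                   (trans (ΣSub-*ˡ n c _) (cong (c ℚ.*_) (none-available p n S)))
  q+p≡1 : q ℚ.+ p ≡ 1ℚ
  q+p≡1 = trans (QP.+-assoc 1ℚ (ℚ.- p) p)
                (trans (cong (1ℚ ℚ.+_) (QP.+-inverseˡ p)) (QP.+-identityʳ 1ℚ))
none-available p (suc n) (inside ∷ S) = begin
  ΣSub n (λ σ → (q ℚ.* weight p σ) ℚ.* none σ) ℚ.+ ΣSub n (λ σ → (p ℚ.* weight p σ) ℚ.* 0ℚ)
    ≡⟨ cong₂ ℚ._+_ (trans (ΣSub-cong n (λ σ → QP.*-assoc q _ _)) (ΣSub-*ˡ n q _))
                   (ΣSub-zero n _ (λ σ → QP.*-zeroʳ (p ℚ.* weight p σ))) ⟩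
  q ℚ.* ΣSub n (λ σ → weight p σ ℚ.* none σ) ℚ.+ 0ℚ
    ≡⟨ QP.+-identityʳ _ ⟩
  q ℚ.* ΣSub n (λ σ → weight p σ ℚ.* none σ)
    ≡⟨ cong (q ℚ.*_) (none-available p n S) ⟩
  q ℚ.* q ^ℚ ∣ S ∣ ∎
  where
  open ℚ-Sums using (ΣSub; ΣSub-cong; ΣSub-*ˡ; ΣSub-zero; χ)
  q = 1ℚ ℚ.- p
  none = λ σ → χ (does (σ ∩ S ⊆? ⊥))

Bin-formula : ∀ t v k p →
  ℚ-Sums.Bin k (λ i → ℚ-Sums.sgn i ℚ.* (1ℚ ℚ.- p) ^ℚ ℤ.∣ e t v k i ∣) ≡ repairFormula t v k p
Bin-formula t v k p = cong (1ℚ ℚ.+_) (trans (Σℕ-cong k term) (Σℕ-applyUpTo k _))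
  where
  open ℚ-Sums using (nat; sgn; Σℕ-cong; Σℕ-applyUpTo)
  y : ℕ → ℚ
  y i = (1ℚ ℚ.- p) ^ℚ ℤ.∣ e t v k i ∣
  term : ∀ i → nat (k C suc i) ℚ.* (sgn (suc i) ℚ.* y (suc i))
               ≡ signℚ (suc i) ℚ.* ((+ (k C suc i)) ℚ./ 1) ℚ.* y (suc i)
  term i = begin
    nat (k C suc i) ℚ.* (sgn (suc i) ℚ.* y (suc i)) ≡⟨ cong₂ (λ c s → c ℚ.* (s ℚ.* y (suc i)))
                                                              (nat-ℚ (k C suc i)) (sgn-ℚ (suc i)) ⟩
    c ℚ.* (signℚ (suc i) ℚ.* y (suc i))             ≡⟨ QP.*-assoc c (signℚ (suc i)) (y (suc i)) ⟨
    c ℚ.* signℚ (suc i) ℚ.* y (suc i)               ≡⟨ cong (ℚ._* y (suc i)) (QP.*-comm c (signℚ (suc i))) ⟩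
    signℚ (suc i) ℚ.* c ℚ.* y (suc i)               ∎
    where c = (+ (k C suc i)) ℚ./ 1

module Repair (t v k b : ℕ) (t≤k : t ≤ k) (X : Fin b → Subset v)
              (D : IsDesign t v k b X) (β : Fin b) where

  open MeetingBlocks t v k b t≤k X D β using (B; meeting; meeting-size)
  open ℚ-Sums
    using (χ; χ-∧; sgn; ΣSub; ΣSub-cong; ΣSub-*ˡ; ΣSub-comm; ΣSub-alternating; ΣSub-below; Bin)

  Covered : Subset b → Fin v → Set
  Covered σ x = ∃ λ i → i ∈ σ × i ≢ β × x ∈ X i

  covered? : ∀ σ x → Dec (Covered σ x)
  covered? σ x = any? (λ i → (i ∈? σ) ×-dec ¬? (i ≟ β) ×-dec (x ∈? X i))

  uncovered? : ∀ σ → Decidable (λ x → ¬ Covered σ x)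
  uncovered? σ x = ¬? (covered? σ x)

  uncovered : Subset b → Subset v
  uncovered σ = setOf (uncovered? σ)

  repair⇔covered : ∀ σ → HasAvailableRepairSet X β σ ⇔ B ∩ uncovered σ ⊆ ⊥
  repair⇔covered σ = mk⇔ to from
    where
    to : HasAvailableRepairSet X β σ → B ∩ uncovered σ ⊆ ⊥
    to (R , (β∉R , cover) , R⊆σ) x∈B∩U with x∈p∩q⁻ B (uncovered σ) x∈B∩U
    ... | x∈B , x∈U with cover _ x∈B
    ...   | i , i∈R , x∈Xi = ⊥-elim (∈-setOf⁻ (uncovered? σ) x∈U
                                       (i , R⊆σ i∈R , (λ { refl → β∉R i∈R }) , x∈Xi))
    -- the available players other than β form a repair set
    in-R? = λ i → (i ∈? σ) ×-dec ¬? (i ≟ β)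
    R : Subset b
    R = setOf in-R?
    from : B ∩ uncovered σ ⊆ ⊥ → HasAvailableRepairSet X β σ
    from B∩U⊆⊥ = R , (β∉R , cover) , R⊆σ
      where
      β∉R : β ∉ R
      β∉R β∈R = proj₂ (∈-setOf⁻ in-R? β∈R) refl
      R⊆σ : R ⊆ σ
      R⊆σ i∈R = proj₁ (∈-setOf⁻ in-R? i∈R)
      cover : ∀ x → x ∈ B → ∃ λ i → i ∈ R × x ∈ X i
      cover x x∈B with covered? σ x
      ... | yes (i , i∈σ , i≢β , x∈Xi) = i , ∈-setOf⁺ in-R? (i∈σ , i≢β) , x∈Xi
      ... | no  ¬covered = ⊥-elim (∉⊥ (B∩U⊆⊥ (x∈p∩q⁺ (x∈B , ∈-setOf⁺ (uncovered? σ) ¬covered))))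

  uncovered⇔unavailable : ∀ I σ → I ⊆ uncovered σ ⇔ σ ∩ meeting I ⊆ ⊥
  uncovered⇔unavailable I σ = mk⇔ to from
    where
    meets? = λ i → ¬? (i ≟ β) ×-dec ¬? (X i ∩ I ⊆? ⊥)
    to : I ⊆ uncovered σ → σ ∩ meeting I ⊆ ⊥
    to I⊆U {i} i∈σ∩M with x∈p∩q⁻ σ (meeting I) i∈σ∩M
    ... | i∈σ , i∈M with ∈-setOf⁻ meets? i∈M
    ...   | i≢β , Xi∩I≢∅ with element (X i ∩ I) Xi∩I≢∅
    ...     | x , x∈Xi∩I with x∈p∩q⁻ (X i) I x∈Xi∩I
    ...       | x∈Xi , x∈I = ⊥-elim (∈-setOf⁻ (uncovered? σ) (I⊆U x∈I) (i , i∈σ , i≢β , x∈Xi))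
    from : σ ∩ meeting I ⊆ ⊥ → I ⊆ uncovered σ
    from σ∩M⊆⊥ {x} x∈I = ∈-setOf⁺ (uncovered? σ) not-covered
      where
      not-covered : ¬ Covered σ x
      not-covered (i , i∈σ , i≢β , x∈Xi) = ∉⊥ (σ∩M⊆⊥ (x∈p∩q⁺ (i∈σ , ∈-setOf⁺ meets? (i≢β , meets-I))))
        where
        meets-I : ¬ X i ∩ I ⊆ ⊥
        meets-I Xi∩I⊆⊥ = ∉⊥ (Xi∩I⊆⊥ (x∈p∩q⁺ (x∈Xi , x∈I)))

  -- Inclusion–exclusion over the points of B: the indicator of repairability
  -- is ∑_{I ⊆ B ∩ U(σ)} (-1)^{|I|}.
  repair-exclusion : (dec : ∀ σ → Dec (HasAvailableRepairSet X β σ)) (p : ℚ) →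
    Prob (HasAvailableRepairSet X β) dec p
      ≡ ΣSub b (λ σ → weight p σ ℚ.* ΣSub v (λ I → χ (does (I ⊆? B ∩ uncovered σ)) ℚ.* sgn ∣ I ∣))
  repair-exclusion dec p = begin
    Prob (HasAvailableRepairSet X β) dec p
      ≡⟨ Prob-expansion (HasAvailableRepairSet X β) dec p ⟩
    ΣSub b (λ σ → weight p σ ℚ.* χ (does (dec σ)))
      ≡⟨ ΣSub-cong b (λ σ → cong (λ a → weight p σ ℚ.* χ a) (repairable σ)) ⟩
    ΣSub b (λ σ → weight p σ ℚ.* χ (does (B ∩ uncovered σ ⊆? ⊥)))
      ≡⟨ ΣSub-cong b (λ σ → cong (weight p σ ℚ.*_) (ΣSub-alternating v (B ∩ uncovered σ))) ⟨
    ΣSub b (λ σ → weight p σ ℚ.* ΣSub v (λ I → χ (does (I ⊆? B ∩ uncovered σ)) ℚ.* sgn ∣ I ∣)) ∎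
    where
    repairable : ∀ σ → does (dec σ) ≡ does (B ∩ uncovered σ ⊆? ⊥)
    repairable σ = does-⇔ (repair⇔covered σ) (dec σ) (B ∩ uncovered σ ⊆? ⊥)

  -- For fixed I, the σ-dependence of a summand is only through the event
  -- "no player of meeting I is available".
  summand-factor : ∀ p I σ →
    weight p σ ℚ.* (χ (does (I ⊆? B ∩ uncovered σ)) ℚ.* sgn ∣ I ∣)
      ≡ (χ (does (I ⊆? B)) ℚ.* sgn ∣ I ∣) ℚ.* (weight p σ ℚ.* χ (does (σ ∩ meeting I ⊆? ⊥)))
  summand-factor p I σ
    rewrite does-⊆?-∩ I B (uncovered σ)
          | does-⇔ (uncovered⇔unavailable I σ) (I ⊆? uncovered σ) (σ ∩ meeting I ⊆? ⊥)
          | χ-∧ (does (I ⊆? B)) (does (σ ∩ meeting I ⊆? ⊥))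
    = rearrange (weight p σ) (χ (does (I ⊆? B))) (χ (does (σ ∩ meeting I ⊆? ⊥))) (sgn ∣ I ∣)
    where
    rearrange : ∀ w a e s → w ℚ.* ((a ℚ.* e) ℚ.* s) ≡ (a ℚ.* s) ℚ.* (w ℚ.* e)
    rearrange = solve 4 (λ w a e s → w :* ((a :* e) :* s) := (a :* s) :* (w :* e)) refl
      where open +-*-Solver

  -- Then independence of the players:
  -- R(p) = ∑_{I ⊆ B} (-1)^{|I|} (1 - p)^{|meeting I|}.
  repair-probability : (dec : ∀ σ → Dec (HasAvailableRepairSet X β σ)) (p : ℚ) →
    Prob (HasAvailableRepairSet X β) dec p
      ≡ ΣSub v (λ I → χ (does (I ⊆? B)) ℚ.* (sgn ∣ I ∣ ℚ.* (1ℚ ℚ.- p) ^ℚ ∣ meeting I ∣))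
  repair-probability dec p = begin
    Prob (HasAvailableRepairSet X β) dec p
      ≡⟨ repair-exclusion dec p ⟩
    ΣSub b (λ σ → w σ ℚ.* ΣSub v (λ I → χ (does (I ⊆? B ∩ uncovered σ)) ℚ.* sgn ∣ I ∣))
      ≡⟨ ΣSub-cong b (λ σ → ΣSub-*ˡ v (w σ) _) ⟨
    ΣSub b (λ σ → ΣSub v (λ I → w σ ℚ.* (χ (does (I ⊆? B ∩ uncovered σ)) ℚ.* sgn ∣ I ∣)))
      ≡⟨ ΣSub-comm b v _ ⟩
    ΣSub v (λ I → ΣSub b (λ σ → w σ ℚ.* (χ (does (I ⊆? B ∩ uncovered σ)) ℚ.* sgn ∣ I ∣)))
      ≡⟨ ΣSub-cong v (λ I → trans (ΣSub-cong b (summand-factor p I)) (ΣSub-*ˡ b (c I) _)) ⟩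
    ΣSub v (λ I → c I ℚ.* ΣSub b (λ σ → w σ ℚ.* χ (does (σ ∩ meeting I ⊆? ⊥))))
      ≡⟨ ΣSub-cong v (λ I → cong (c I ℚ.*_) (none-available p b (meeting I))) ⟩
    ΣSub v (λ I → c I ℚ.* (1ℚ ℚ.- p) ^ℚ ∣ meeting I ∣)
      ≡⟨ ΣSub-cong v (λ I → QP.*-assoc (χ (does (I ⊆? B))) (sgn ∣ I ∣) _) ⟩
    ΣSub v (λ I → χ (does (I ⊆? B)) ℚ.* (sgn ∣ I ∣ ℚ.* (1ℚ ℚ.- p) ^ℚ ∣ meeting I ∣)) ∎
    where
    w = weight p
    c : Subset v → ℚ
    c I = χ (does (I ⊆? B)) ℚ.* sgn ∣ I ∣

  grouped : ∀ p →
    ΣSub v (λ I → χ (does (I ⊆? B)) ℚ.* (sgn ∣ I ∣ ℚ.* (1ℚ ℚ.- p) ^ℚ ∣ meeting I ∣))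
      ≡ Bin k (λ i → sgn i ℚ.* (1ℚ ℚ.- p) ^ℚ ℤ.∣ e t v k i ∣)
  grouped p = begin
    ΣSub v (λ I → χ (does (I ⊆? B)) ℚ.* (sgn ∣ I ∣ ℚ.* (1ℚ ℚ.- p) ^ℚ ∣ meeting I ∣))
      ≡⟨ ΣSub-cong v by-size ⟩
    ΣSub v (λ I → χ (does (I ⊆? B)) ℚ.* h ∣ I ∣)
      ≡⟨ ΣSub-below v B h ⟩
    Bin ∣ B ∣ h
      ≡⟨ cong (λ m → Bin m h) (IsDesign.blockSize D β) ⟩
    Bin k h ∎
    where
    h : ℕ → ℚ
    h i = sgn i ℚ.* (1ℚ ℚ.- p) ^ℚ ℤ.∣ e t v k i ∣
    by-size : ∀ I → χ (does (I ⊆? B)) ℚ.* (sgn ∣ I ∣ ℚ.* (1ℚ ℚ.- p) ^ℚ ∣ meeting I ∣)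
                    ≡ χ (does (I ⊆? B)) ℚ.* h ∣ I ∣
    by-size I with I ⊆? B
    ... | yes I⊆B = cong (λ n → 1ℚ ℚ.* (sgn ∣ I ∣ ℚ.* (1ℚ ℚ.- p) ^ℚ n))
                         (cong ℤ.∣_∣ (meeting-size I I⊆B))
    ... | no  _   = trans (QP.*-zeroˡ (sgn ∣ I ∣ ℚ.* (1ℚ ℚ.- p) ^ℚ ∣ meeting I ∣))
                          (sym (QP.*-zeroˡ (h ∣ I ∣)))

theorem3p6 : (t v k b : ℕ) → 1 ≤ t → t ≤ k →
    (blocks : Fin b → Subset v) → IsDesign t v k b blocks →
    (β : Fin b) →
    (dec : (σ : Subset b) → Dec (HasAvailableRepairSet blocks β σ)) →
    (p : ℚ) → 0ℚ ≤ℚ p → p ≤ℚ 1ℚ →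
    Prob (HasAvailableRepairSet blocks β) dec p ≡ repairFormula t v k p
theorem3p6 t v k b _ t≤k blocks D β dec p _ _ = begin
  Prob (HasAvailableRepairSet blocks β) dec p
    ≡⟨ repair-probability dec p ⟩
  ΣSub v (λ I → χ (does (I ⊆? B)) ℚ.* (sgn ∣ I ∣ ℚ.* (1ℚ ℚ.- p) ^ℚ ∣ meeting I ∣))
    ≡⟨ grouped p ⟩
  Bin k (λ i → sgn i ℚ.* (1ℚ ℚ.- p) ^ℚ ℤ.∣ e t v k i ∣)
    ≡⟨ Bin-formula t v k p ⟩
  repairFormula t v k p ∎
  where
  open Repair t v k b t≤k blocks D β using (repair-probability; grouped)
  open MeetingBlocks t v k b t≤k blocks D β using (B; meeting)
  open ℚ-Sums using (ΣSub; Bin; χ; sgn)
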